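{- Let $Q\ge 2$ be an integer, let $i\in\mathbb{Z}$, and let $k\ge 3$ be an integer. Then \[ \begin{pmatrix}\nu_{k-1}(\gamma_i)&\nu_k(\gamma_i)\\ \nu_{k-2}(\gamma_{i+1})&\nu_{k-1}(\gamma_{i+1})\end{pmatrix}\in SL_2(\mathbb{Z}). \]
   Context: For $Q\in\mathbb{N}$, the Farey fractions of order $Q$ are $\mathcal{F}_Q=\{a/q\in\mathbb{Q}: 1\le q\le Q,\ 0<a\le q,\ \gcd(a,q)=1\}$. Write $\mathcal{F}_Q=\{\gamma_1,\ldots,\gamma_{N(Q)}\}$ with $1/Q=\gamma_1<\gamma_2<\cdots<\gamma_{N(Q)}=1$, and extend to all $i\in\mathbb{Z}$ by $\gamma_{i+N(Q)}=\gamma_i+1$. Write $\gamma_i=p_i/q_i$ in lowest terms with $q_i>0$. For a positive integer $k$, the $k$-index of $\gamma_i$ is $\nu_k(\gamma_i)=p_{i+k-1}q_{i-1}-p_{i-1}q_{i+k-1}$ (relative to $Q$). -}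

module Defs where

open import Data.Nat as ℕ using (ℕ; zero; suc)
open import Data.Nat.GCD using (gcd)
open import Data.Integer as ℤ using (ℤ; +_; _-_; _*_)
open import Data.Integer.DivMod using (_/ℕ_; _%ℕ_)
open import Data.Rational as ℚ using (ℚ; ↥_; ↧ₙ_)
open import Data.Rational.Properties using (≤-decTotalOrder)
open import Data.List using (List; []; _∷_; length; concatMap; filterᵇ; map; upTo)
open import Data.Bool using (Bool)
import Data.List.Sort as Sort
open import Relation.Binary.PropositionalEquality using (_≡_)

-- all a/q with 1 ≤ q ≤ Q, 1 ≤ a ≤ q, gcd(a,q) = 1 (as rationals a/q)
fareyCandidates : ℕ → List ℚ
fareyCandidates Q = concatMap (λ q′ → map (λ a′ → (+ suc a′) ℚ./ suc q′)
                                        (filterᵇ (λ a′ → gcd (suc a′) (suc q′) ℕ.≡ᵇ 1) (upTo (suc q′))))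
                              (upTo Q)

-- F_Q listed in increasing order: γ_1 < … < γ_{N(Q)} (0-indexed list)
farey : ℕ → List ℚ
farey Q = Sort.sort ≤-decTotalOrder (fareyCandidates Q)

N : ℕ → ℕ
N Q = length (farey Q)

nth : List ℚ → ℕ → ℚ
nth []       _       = ℚ.0ℚ
nth (x ∷ xs) zero    = x
nth (x ∷ xs) (suc n) = nth xs n

-- For i ∈ ℤ write i - 1 = N·m + r with 0 ≤ r < N; then γ_i = F[r] + m,
-- i.e. the extension γ_{i+N} = γ_i + 1 of γ_1 < … < γ_N.
-- p_i and q_i: numerator and positive denominator of γ_i in lowest terms.
numer : ℕ → ℤ → ℤ
numer Q i with N Q
... | zero  = + 0
... | suc n = let j = i - + 1
                  x = nth (farey Q) (j %ℕ suc n)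
              in ↥ x ℤ.+ (j /ℕ suc n) * (+ (↧ₙ x))

denom : ℕ → ℤ → ℤ
denom Q i with N Q
... | zero  = + 1
... | suc n = + (↧ₙ (nth (farey Q) ((i - + 1) %ℕ suc n)))

ν : ℕ → ℕ → ℤ → ℤ
ν Q k i = numer Q (i ℤ.+ + k - + 1) * denom Q (i - + 1)
        - numer Q (i - + 1) * denom Q (i ℤ.+ + k - + 1)

InSL₂ℤ : ℤ → ℤ → ℤ → ℤ → Set
InSL₂ℤ a b c d = a * d - b * c ≡ + 1

-- Write Δ m n = p_n q_m − p_m q_n for the minor of the vectors (p_m, q_m)
-- and (p_n, q_n); then ν_k(γ_i) = Δ (i − 1) (i + k − 1).  The three-term
-- Plücker relation Δ(a,c)Δ(b,e) − Δ(a,e)Δ(b,c) = Δ(a,b)Δ(c,e), applied to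
-- a = i − 1, b = i, c = i + k − 2, e = i + k − 1, turns the determinant of
-- the matrix into Δ(i−1, i) · Δ(i+k−2, i+k−1).  So the theorem follows from
-- the classical neighbour property of Farey fractions: Δ(j, j+1) = 1 for
-- every j ∈ ℤ (module `Minors`, lemma `index-matrix-SL₂`).
module Submission where

open import Defs
open import Data.Nat using (ℕ; _≥_)
open import Data.Integer using (ℤ; +_; _+_)

open import Data.Nat as ℕ using (zero; suc; s≤s; z≤n)
import Data.Nat.Properties as ℕP
open import Data.Nat.GCD using (gcd; gcd-zeroˡ; gcd-greatest; module Bézout)
open import Data.Nat.Coprimality using (coprime-Bézout; Bézout-coprime; coprime⇒gcd≡1; gcd≡1⇒coprime)
open import Data.Nat.Divisibility using (_∣_; ∣1⇒≡1; ∣-refl)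
open import Data.Integer as ℤ using (_-_; _*_; -_)
import Data.Integer.Properties as ℤP
open import Data.Integer.DivMod using (_/ℕ_; _%ℕ_; n%ℕd<d; a≡a%ℕn+[a/ℕn]*n; [n/ℕd]*d≤n; n<s[n/ℕd]*d)
open import Data.Integer.Tactic.RingSolver using (solve-∀)
open import Algebra.Properties.AbelianGroup ℤP.+-0-abelianGroup using (∙-cancelʳ)
import Data.Integer.GCD as ℤG
open import Data.Rational as ℚ using (ℚ; ↥_; ↧_; ↧ₙ_; *<*; *≤*; *≡*)
import Data.Rational.Properties as ℚP
open import Data.List using (List; []; _∷_; length; filterᵇ; map; upTo)
open import Data.List.Membership.Propositional using (_∈_; find; lose)
open import Data.List.Membership.Propositional.Properties
  using (∈-concatMap⁻; ∈-concatMap⁺; ∈-map∘filter⁻; ∈-map∘filter⁺; ∈-upTo⁻; ∈-upTo⁺)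
open import Data.List.Relation.Unary.Any using (here; there)
import Data.List.Relation.Unary.All as All
import Data.List.Relation.Unary.All.Properties as AllP
open import Data.List.Relation.Unary.AllPairs as AllPairs using (AllPairs; _∷_)
import Data.List.Relation.Unary.AllPairs.Properties as AllPairsP
open import Data.List.Relation.Unary.Linked.Properties using (Linked⇒AllPairs)
open import Data.List.Relation.Binary.Permutation.Propositional using (_↭_; ↭-sym; ↭⇒↭ₛ)
open import Data.List.Relation.Binary.Permutation.Propositional.Properties using (∈-resp-↭)
import Data.List.Relation.Binary.Permutation.Setoid.Properties as PermutationₛP
import Data.List.Sort as Sort
open import Data.Bool using (Bool)
open import Function using (_∘_; id)
open import Relation.Nullary.Decidable using (T?)
open import Data.Product using (_×_; _,_; proj₁; proj₂; Σ)
open import Data.Sum using (inj₁; inj₂)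
open import Data.Empty using (⊥-elim)
open import Relation.Binary.Definitions using (tri<; tri≈; tri>)
open import Relation.Binary.PropositionalEquality

module Minors (p q : ℤ → ℤ) where

  Δ : ℤ → ℤ → ℤ
  Δ m n = p n * q m - p m * q n

  plücker : ∀ a b c e → Δ a c * Δ b e - Δ a e * Δ b c ≡ Δ a b * Δ c e
  plücker a b c e = identity (p a) (q a) (p b) (q b) (p c) (q c) (p e) (q e)
    where
    identity : ∀ pa qa pb qb pc qc pe qe →
      (pc * qa - pa * qc) * (pe * qb - pb * qe) - (pe * qa - pa * qe) * (pc * qb - pb * qc)
        ≡ (pb * qa - pa * qb) * (pe * qc - pc * qe)
    identity = solve-∀

  Unimodular : Set
  Unimodular = ∀ j → Δ j (j + + 1) ≡ + 1

  adjacent-minors-SL₂ : Unimodular → ∀ a c →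
    InSL₂ℤ (Δ a c) (Δ a (c + + 1)) (Δ (a + + 1) c) (Δ (a + + 1) (c + + 1))
  adjacent-minors-SL₂ uni a c =
    trans (plücker a (a + + 1) c (c + + 1)) (cong₂ _*_ (uni a) (uni c))

  -- The matrix of the theorem for k = m + 2: its entries ν_{k−1}(γ_i),
  -- ν_k(γ_i), ν_{k−2}(γ_{i+1}), ν_{k−1}(γ_{i+1}) are the minors of the
  -- pair (a, a+1) against (c, c+1), where a = i − 1 and c = i + k − 2.
  index-matrix-SL₂ : Unimodular → ∀ i m →
    InSL₂ℤ (Δ (i - + 1) (i + + suc m - + 1)) (Δ (i - + 1) (i + + suc (suc m) - + 1))
           (Δ (i + + 1 - + 1) (i + + 1 + + m - + 1)) (Δ (i + + 1 - + 1) (i + + 1 + + suc m - + 1))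
  index-matrix-SL₂ uni i m =
    reindex (i+1-1≡a+1 i) (i+k-1≡c+1 i (+ m)) (i+1+[k-2]-1≡c i (+ m)) (i+1+[k-1]-1≡c+1 i (+ m))
            (adjacent-minors-SL₂ uni a c)
    where
    a c : ℤ
    a = i - + 1
    c = i + + suc m - + 1
    reindex : ∀ {a′ c₁ c′ c₁′} → a′ ≡ a + + 1 → c₁ ≡ c + + 1 → c′ ≡ c → c₁′ ≡ c + + 1 →
      InSL₂ℤ (Δ a c) (Δ a (c + + 1)) (Δ (a + + 1) c) (Δ (a + + 1) (c + + 1)) →
      InSL₂ℤ (Δ a c) (Δ a c₁) (Δ a′ c′) (Δ a′ c₁′)
    reindex refl refl refl refl det≡1 = det≡1
    i+1-1≡a+1 : ∀ i → i + + 1 - + 1 ≡ i - + 1 + + 1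
    i+1-1≡a+1 = solve-∀
    i+k-1≡c+1 : ∀ i m → i + (+ 1 + (+ 1 + m)) - + 1 ≡ i + (+ 1 + m) - + 1 + + 1
    i+k-1≡c+1 = solve-∀
    i+1+[k-2]-1≡c : ∀ i m → i + + 1 + m - + 1 ≡ i + (+ 1 + m) - + 1
    i+1+[k-2]-1≡c = solve-∀
    i+1+[k-1]-1≡c+1 : ∀ i m → i + + 1 + (+ 1 + m) - + 1 ≡ i + (+ 1 + m) - + 1 + + 1
    i+1+[k-1]-1≡c+1 = solve-∀

divmod-unique : ∀ M .{{_ : ℕ.NonZero M}} t r m → r ℕ.< M →
  t ≡ + r + m * + M → t %ℕ M ≡ r × t /ℕ M ≡ m
divmod-unique M t r m r<M t≡ = remainder , sym quotient
  where
  bracket-unique : ∀ m d → m * + M ℤ.≤ t → t ℤ.< (+ 1 + m) * + M →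
    d * + M ℤ.≤ t → t ℤ.< (+ 1 + d) * + M → m ≡ d
  bracket-unique m d m≤ <m d≤ <d with ℤP.<-cmp m d
  ... | tri≈ _ m≡d _ = m≡d
  ... | tri< m<d _ _ = ⊥-elim (ℤP.<-irrefl refl
          (ℤP.<-≤-trans <m (ℤP.≤-trans (ℤP.*-monoʳ-≤-nonNeg (+ M) (ℤP.i<j⇒suc[i]≤j m<d)) d≤)))
  ... | tri> _ _ d<m = ⊥-elim (ℤP.<-irrefl refl
          (ℤP.<-≤-trans <d (ℤP.≤-trans (ℤP.*-monoʳ-≤-nonNeg (+ M) (ℤP.i<j⇒suc[i]≤j d<m)) m≤)))

  next-multiple : + M + m * + M ≡ (+ 1 + m) * + M
  next-multiple = ring (+ M) m
    where
    ring : ∀ M m → M + m * M ≡ (+ 1 + m) * M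
    ring = solve-∀

  quotient : m ≡ t /ℕ M
  quotient = bracket-unique m (t /ℕ M) m≤t t<next ([n/ℕd]*d≤n t M) (n<s[n/ℕd]*d t M)
    where
    open ℤP.≤-Reasoning
    m≤t : m * + M ℤ.≤ t
    m≤t = begin
      m * + M       ≤⟨ ℤP.i≤j+i (m * + M) (+ r) ⟩
      + r + m * + M ≡⟨ sym t≡ ⟩
      t             ∎
    t<next : t ℤ.< (+ 1 + m) * + M
    t<next = begin-strict
      t                 ≡⟨ t≡ ⟩
      + r + m * + M     <⟨ ℤP.+-monoˡ-< (m * + M) (ℤ.+<+ r<M) ⟩
      + M + m * + M     ≡⟨ next-multiple ⟩
      (+ 1 + m) * + M   ∎

  remainder : t %ℕ M ≡ r
  remainder = ℤP.+-injective (∙-cancelʳ (t /ℕ M * + M) (+ (t %ℕ M)) (+ r)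
    (trans (sym (a≡a%ℕn+[a/ℕn]*n t M)) (trans t≡ (cong (λ q → + r + q * + M) quotient))))

det : ℚ → ℚ → ℤ
det x y = ↥ y * ↧ x - ↥ x * ↧ y

-- The integer sequences obtained from a nonempty list L = [x₀, …, x_n] of
-- rationals by the periodic extension x_{r + mM} = x_r + m (M = n + 1),
-- written exactly as `numer` and `denom` extend F_Q (denominators as
-- + ↧ₙ x), so that the two agree by computation.
module PeriodicExtension (L : List ℚ) (n : ℕ) where

  M : ℕ
  M = suc n

  shiftedNum : ℕ → ℤ → ℤ
  shiftedNum r m = ↥ nth L r + m * (+ (↧ₙ nth L r))

  den : ℕ → ℤ
  den r = + (↧ₙ nth L r)

  extNum extDen : ℤ → ℤ
  extNum t = shiftedNum (t %ℕ M) (t /ℕ M)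
  extDen t = den (t %ℕ M)

  digitDet : ℕ → ℤ → ℕ → ℤ → ℤ
  digitDet r m r′ m′ = shiftedNum r′ m′ * den r - shiftedNum r m * den r′

  -- translating two rationals by the same integer keeps their determinant
  within-period : ∀ r m → digitDet r m (suc r) m ≡ det (nth L r) (nth L (suc r))
  within-period r m = ring (↥ nth L (suc r)) (↧ nth L (suc r)) (↥ nth L r) (↧ nth L r) m
    where
    ring : ∀ a b c d m → (a + m * b) * d - (c + m * d) * b ≡ a * d - c * b
    ring = solve-∀

  -- the step from x_n + m to x₀ + (m + 1) across two periods
  across-period : ∀ m → digitDet n m 0 (+ 1 + m) ≡
    (↥ nth L 0 + ↧ nth L 0) * ↧ nth L n - ↥ nth L n * ↧ nth L 0
  across-period m = ring (↥ nth L 0) (↧ nth L 0) (↥ nth L n) (↧ nth L n) m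
    where
    ring : ∀ a b c d m → (a + (+ 1 + m) * b) * d - (c + m * d) * b ≡ (a + b) * d - c * b
    ring = solve-∀

  succ-expansion : ∀ t → t + + 1 ≡ + suc (t %ℕ M) + (t /ℕ M) * + M
  succ-expansion t = trans (cong (_+ + 1) (a≡a%ℕn+[a/ℕn]*n t M)) (ring (+ (t %ℕ M)) ((t /ℕ M) * + M))
    where
    ring : ∀ r x → r + x + + 1 ≡ (+ 1 + r) + x
    ring = solve-∀

  succ-digits-within : ∀ t → suc (t %ℕ M) ℕ.< M →
    (t + + 1) %ℕ M ≡ suc (t %ℕ M) × (t + + 1) /ℕ M ≡ t /ℕ M
  succ-digits-within t not-last = divmod-unique M (t + + 1) _ _ not-last (succ-expansion t)

  succ-digits-across : ∀ t → suc (t %ℕ M) ≡ M →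
    (t + + 1) %ℕ M ≡ 0 × (t + + 1) /ℕ M ≡ + 1 + t /ℕ M
  succ-digits-across t last = divmod-unique M (t + + 1) 0 _ (s≤s z≤n) (begin
    t + + 1                      ≡⟨ succ-expansion t ⟩
    + suc (t %ℕ M) + q * + M     ≡⟨ cong (λ r → + r + q * + M) last ⟩
    + M + q * + M                ≡⟨ ring (+ M) q ⟩
    + 0 + (+ 1 + q) * + M        ∎)
    where
    open ≡-Reasoning
    q : ℤ
    q = t /ℕ M
    ring : ∀ M q → M + q * M ≡ + 0 + (+ 1 + q) * M
    ring = solve-∀

  extension-unimodular :
    (∀ r → suc r ℕ.< M → det (nth L r) (nth L (suc r)) ≡ + 1) →
    (↥ nth L 0 + ↧ nth L 0) * ↧ nth L n - ↥ nth L n * ↧ nth L 0 ≡ + 1 →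
    Minors.Unimodular extNum extDen
  extension-unimodular consecutive wrap t
    with ℕP.m≤n⇒m<n∨m≡n (n%ℕd<d t M)
  ... | inj₁ not-last =
    let (r′≡ , m′≡) = succ-digits-within t not-last
    in subst₂ (λ r′ m′ → digitDet r m r′ m′ ≡ + 1) (sym r′≡) (sym m′≡)
              (trans (within-period r m) (consecutive r not-last))
    where
    r : ℕ
    r = t %ℕ M
    m : ℤ
    m = t /ℕ M
  ... | inj₂ last =
    let (r′≡ , m′≡) = succ-digits-across t last
    in subst₂ (λ r′ m′ → digitDet r m r′ m′ ≡ + 1) (sym r′≡) (sym m′≡)
              (subst (λ r → digitDet r m 0 (+ 1 + m) ≡ + 1) (sym (ℕP.suc-injective last))
                     (trans (across-period m) wrap))
    where
    r : ℕ
    r = t %ℕ M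
    m : ℤ
    m = t /ℕ M

module StrictlyIncreasing where

  nth-∈ : ∀ (L : List ℚ) r → r ℕ.< length L → nth L r ∈ L
  nth-∈ (x ∷ xs) zero    _         = here refl
  nth-∈ (x ∷ xs) (suc r) (s≤s r<n) = there (nth-∈ xs r r<n)

  nth-< : ∀ L → AllPairs ℚ._<_ L → ∀ r → suc r ℕ.< length L → nth L r ℚ.< nth L (suc r)
  nth-< (x ∷ y ∷ xs) ((x<y All.∷ _) ∷ _) zero    _         = x<y
  nth-< (x ∷ xs)     (_ ∷ sorted)         (suc r) (s≤s r<n) = nth-< xs sorted r r<n

  nth-next-least : ∀ L → AllPairs ℚ._<_ L → ∀ r → suc r ℕ.< length L →
    ∀ {w} → w ∈ L → nth L r ℚ.< w → nth L (suc r) ℚ.≤ w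
  nth-next-least (x ∷ y ∷ xs) _ zero _ (here refl) x<x = ⊥-elim (ℚP.<-irrefl refl x<x)
  nth-next-least (x ∷ y ∷ xs) _ zero _ (there (here refl)) _ = ℚP.≤-refl
  nth-next-least (x ∷ y ∷ xs) (_ ∷ (y<xs ∷ _)) zero _ (there (there w∈)) _ =
    ℚP.<⇒≤ (All.lookup y<xs w∈)
  nth-next-least (x ∷ xs) (x<xs ∷ _) (suc r) (s≤s r<n) (here refl) xr<x =
    ⊥-elim (ℚP.<-asym (All.lookup x<xs (nth-∈ xs r (ℕP.<-trans (ℕP.n<1+n r) r<n))) xr<x)
  nth-next-least (x ∷ xs) (_ ∷ sorted) (suc r) (s≤s r<n) (there w∈) xr<w =
    nth-next-least xs sorted r r<n w∈ xr<w

  nth-first-least : ∀ L → AllPairs ℚ._<_ L → ∀ {w} → w ∈ L → nth L 0 ℚ.≤ w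
  nth-first-least (x ∷ xs) _          (here refl) = ℚP.≤-refl
  nth-first-least (x ∷ xs) (x<xs ∷ _) (there w∈)  = ℚP.<⇒≤ (All.lookup x<xs w∈)

  nth-last-greatest : ∀ L n → length L ≡ suc n → AllPairs ℚ._<_ L → ∀ {w} → w ∈ L → w ℚ.≤ nth L n
  nth-last-greatest (x ∷ [])         zero    _   _          (here refl) = ℚP.≤-refl
  nth-last-greatest (x ∷ xs@(_ ∷ _)) (suc n) len (x<xs ∷ _) (here refl) =
    ℚP.<⇒≤ (All.lookup x<xs (nth-∈ xs n (ℕP.≤-reflexive (sym (ℕP.suc-injective len)))))
  nth-last-greatest (x ∷ xs@(_ ∷ _)) (suc n) len (_ ∷ sorted) (there w∈) =
    nth-last-greatest xs n (ℕP.suc-injective len) sorted w∈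

record FareyFraction (Q : ℕ) (x : ℚ) : Set where
  field
    a b     : ℕ
    num     : ↥ x ≡ + a
    den     : ↧ x ≡ + b
    1≤a     : 1 ℕ.≤ a
    a≤b     : a ℕ.≤ b
    b≤Q     : b ℕ.≤ Q
    coprime : gcd a b ≡ 1

record MemberWith (L : List ℚ) (a b : ℕ) : Set where
  field
    w   : ℚ
    ∈L  : w ∈ L
    num : ↥ w ≡ + a
    den : ↧ w ≡ + b

record Enumerates (Q : ℕ) (L : List ℚ) : Set where
  field
    increasing : AllPairs ℚ._<_ L
    member⁻    : ∀ {x} → x ∈ L → FareyFraction Q x
    member⁺    : ∀ a b → 1 ℕ.≤ a → a ℕ.≤ b → b ℕ.≤ Q → gcd a b ≡ 1 → MemberWith L a b

-- The list `fareyCandidates Q` enumerates F_Q without repetitions, so its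
-- sorted version `farey Q` is strictly increasing.
module FareyCandidates where

  fraction : ℕ → ℕ → ℚ
  fraction q′ a′ = (+ suc a′) ℚ./ suc q′

  coprime? : ℕ → ℕ → Bool
  coprime? q′ a′ = gcd (suc a′) (suc q′) ℕ.≡ᵇ 1

  block : ℕ → List ℚ
  block q′ = map (fraction q′) (filterᵇ (coprime? q′) (upTo (suc q′)))

  ∈-block⁻ : ∀ {q′ x} → x ∈ block q′ →
    Σ ℕ λ a′ → a′ ℕ.< suc q′ × x ≡ fraction q′ a′ × gcd (suc a′) (suc q′) ≡ 1
  ∈-block⁻ {q′} x∈ with ∈-map∘filter⁻ (fraction q′) (T? ∘ coprime? q′) x∈
  ... | a′ , a′∈ , x≡ , coprime = a′ , ∈-upTo⁻ a′∈ , x≡ , ℕP.≡ᵇ⇒≡ _ _ coprime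

  reduced-fraction : ∀ q′ a′ → gcd (suc a′) (suc q′) ≡ 1 →
    ↥ fraction q′ a′ ≡ + suc a′ × ↧ fraction q′ a′ ≡ + suc q′
  reduced-fraction q′ a′ coprime
    rewrite ℚP.normalize-coprime {suc a′} {q′} (gcd≡1⇒coprime coprime) = refl , refl

  fraction-injective : ∀ q′ i j → fraction q′ i ≡ fraction q′ j → i ≡ j
  fraction-injective q′ i j x≡ = ℕP.suc-injective (ℤP.+-injective (begin
    + suc i              ≡⟨ sym (ℚP.↥-/ (+ suc i) (suc q′)) ⟩
    ↥ fraction q′ i * gᵢ  ≡⟨ cong₂ _*_ (cong ↥_ x≡) gᵢ≡gⱼ ⟩
    ↥ fraction q′ j * gⱼ  ≡⟨ ℚP.↥-/ (+ suc j) (suc q′) ⟩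
    + suc j              ∎))
    where
    open ≡-Reasoning
    gᵢ gⱼ : ℤ
    gᵢ = ℤG.gcd (+ suc i) (+ suc q′)
    gⱼ = ℤG.gcd (+ suc j) (+ suc q′)
    -- both gcds are the factor cancelled from the common denominator
    gᵢ≡gⱼ : gᵢ ≡ gⱼ
    gᵢ≡gⱼ = ℤP.*-cancelˡ-≡ (↧ fraction q′ j) gᵢ gⱼ (trans
      (cong (λ x → ↧ x * gᵢ) (sym x≡))
      (trans (ℚP.↧-/ (+ suc i) (suc q′)) (sym (ℚP.↧-/ (+ suc j) (suc q′)))))

  block-distinct : ∀ q′ → AllPairs _≢_ (block q′)
  block-distinct q′ = AllPairsP.map⁺ (AllPairsP.filter⁺ (T? ∘ coprime? q′)
    (AllPairsP.applyUpTo⁺₁ id (suc q′) (λ i<j _ i≡j → ℕP.<-irrefl (fraction-injective q′ _ _ i≡j) i<j)))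

  block-denominator : ∀ q′ {x} → x ∈ block q′ → ↧ x ≡ + suc q′
  block-denominator q′ x∈ with ∈-block⁻ x∈
  ... | a′ , _ , refl , coprime = proj₂ (reduced-fraction q′ a′ coprime)

  -- blocks are internally distinct and have pairwise different denominators
  candidates-distinct : ∀ Q → AllPairs _≢_ (fareyCandidates Q)
  candidates-distinct Q = AllPairsP.concat⁺ (AllP.map⁺ (All.tabulate (λ {q′} _ → block-distinct q′)))
    (AllPairsP.map⁺ (AllPairsP.applyUpTo⁺₁ id Q (λ {i} {j} i<j _ →
      All.tabulate (λ x∈ → All.tabulate (λ y∈ x≡y → ℕP.<-irrefl
        (ℕP.suc-injective (ℤP.+-injective
          (trans (sym (block-denominator i x∈)) (trans (cong ↧_ x≡y) (block-denominator j y∈)))))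
        i<j)))))

  candidate⁻ : ∀ Q {x} → x ∈ fareyCandidates Q → FareyFraction Q x
  candidate⁻ Q x∈ with find (∈-concatMap⁻ block {xs = upTo Q} x∈)
  ... | q′ , q′∈ , x∈block with ∈-block⁻ x∈block
  ...   | a′ , a′< , refl , coprime = record
    { a = suc a′ ; b = suc q′
    ; num = proj₁ (reduced-fraction q′ a′ coprime) ; den = proj₂ (reduced-fraction q′ a′ coprime)
    ; 1≤a = s≤s z≤n ; a≤b = a′< ; b≤Q = ∈-upTo⁻ q′∈ ; coprime = coprime }

  candidate⁺ : ∀ Q a b → 1 ℕ.≤ a → a ℕ.≤ b → b ℕ.≤ Q → gcd a b ≡ 1 → MemberWith (fareyCandidates Q) a b
  candidate⁺ Q (suc a′) (suc q′) _ a≤b b≤Q coprime = record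
    { w = fraction q′ a′
    ; ∈L = ∈-concatMap⁺ block (lose (∈-upTo⁺ b≤Q)
             (∈-map∘filter⁺ (fraction q′) (T? ∘ coprime? q′) (a′ , ∈-upTo⁺ a≤b , refl , ℕP.≡⇒≡ᵇ _ _ coprime)))
    ; num = proj₁ (reduced-fraction q′ a′ coprime)
    ; den = proj₂ (reduced-fraction q′ a′ coprime) }

≤∧≢⇒< : ∀ {x y : ℚ} → x ℚ.≤ y → x ≢ y → x ℚ.< y
≤∧≢⇒< {x} {y} x≤y x≢y with ℚP.<-cmp x y
... | tri< x<y _ _ = x<y
... | tri≈ _ x≡y _ = ⊥-elim (x≢y x≡y)
... | tri> _ _ y<x = ⊥-elim (ℚP.<-irrefl refl (ℚP.<-≤-trans y<x x≤y))

farey-enumerates : ∀ Q → Enumerates Q (farey Q)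
farey-enumerates Q = record
  { increasing = AllPairs.zipWith (λ (x≤y , x≢y) → ≤∧≢⇒< x≤y x≢y) (nondecreasing , distinct)
  ; member⁻ = λ x∈ → candidate⁻ Q (∈-resp-↭ sorted↭candidates x∈)
  ; member⁺ = λ a b 1≤a a≤b b≤Q coprime →
      let m = candidate⁺ Q a b 1≤a a≤b b≤Q coprime
      in record { MemberWith m ; ∈L = ∈-resp-↭ (↭-sym sorted↭candidates) (MemberWith.∈L m) } }
  where
  open FareyCandidates using (candidates-distinct; candidate⁻; candidate⁺)
  sorted↭candidates : farey Q ↭ fareyCandidates Q
  sorted↭candidates = Sort.sort-↭ ℚP.≤-decTotalOrder (fareyCandidates Q)
  nondecreasing : AllPairs ℚ._≤_ (farey Q)
  nondecreasing = Linked⇒AllPairs ℚP.≤-trans (Sort.sort-↗ ℚP.≤-decTotalOrder (fareyCandidates Q))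
  distinct : AllPairs _≢_ (farey Q)
  distinct = PermutationₛP.Unique-resp-↭ (setoid ℚ) (↭⇒↭ₛ (↭-sym sorted↭candidates)) (candidates-distinct Q)

1+*≡*-in-ℤ : ∀ m n k l → 1 ℕ.+ m ℕ.* n ≡ k ℕ.* l → + 1 + + m * + n ≡ + k * + l
1+*≡*-in-ℤ m n k l eq =
  trans (cong (λ z → + 1 + z) (sym (ℤP.pos-* m n))) (trans (cong +_ eq) (ℤP.pos-* k l))

bezout-integers : ∀ a b → gcd a b ≡ 1 → Σ ℤ λ s → Σ ℤ λ y → + b * s ≡ + a * y + + 1
bezout-integers a b coprime with coprime-Bézout (gcd≡1⇒coprime {a} {b} coprime)
... | Bézout.+- x y eq = - + y , - + x , negated (+ a) (+ b) (+ x) (+ y) (1+*≡*-in-ℤ y b x a eq)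
  where
  open ≡-Reasoning
  negated : ∀ a b x y → + 1 + y * b ≡ x * a → b * - y ≡ a * - x + + 1
  negated a b x y E = begin
    b * - y              ≡⟨ ring₁ b y ⟩
    + 1 - (+ 1 + y * b)  ≡⟨ cong (λ z → + 1 - z) E ⟩
    + 1 - x * a          ≡⟨ ring₂ a x ⟩
    a * - x + + 1        ∎
    where
    ring₁ : ∀ b y → b * - y ≡ + 1 - (+ 1 + y * b)
    ring₁ = solve-∀
    ring₂ : ∀ a x → + 1 - x * a ≡ a * - x + + 1
    ring₂ = solve-∀
... | Bézout.-+ x y eq = + y , + x , direct (+ a) (+ b) (+ x) (+ y) (1+*≡*-in-ℤ x a y b eq)
  where
  open ≡-Reasoning
  direct : ∀ a b x y → + 1 + x * a ≡ y * b → b * y ≡ a * x + + 1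
  direct a b x y E = begin
    b * y          ≡⟨ ℤP.*-comm b y ⟩
    y * b          ≡⟨ sym E ⟩
    + 1 + x * a    ≡⟨ ring a x ⟩
    a * x + + 1    ∎
    where
    ring : ∀ a x → + 1 + x * a ≡ a * x + + 1
    ring = solve-∀

representative-in-window : ∀ Q b .{{_ : ℕ.NonZero b}} → b ℕ.≤ Q → ∀ y →
  Σ ℕ λ Y → Σ ℤ λ h → + Y ≡ y + h * + b × Y ℕ.≤ Q × Q ℕ.< b ℕ.+ Y
representative-in-window Q b b≤Q y = Q ℕ.∸ m , h , Y≡ , ℕP.m∸n≤m Q m , Q<b+Y
  where
  open ≡-Reasoning
  m : ℕ
  m = (+ Q - y) %ℕ b
  h : ℤ
  h = (+ Q - y) /ℕ b
  m<b : m ℕ.< b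
  m<b = n%ℕd<d (+ Q - y) b
  m≤Q : m ℕ.≤ Q
  m≤Q = ℕP.<⇒≤ (ℕP.<-≤-trans m<b b≤Q)
  Y≡ : + (Q ℕ.∸ m) ≡ y + h * + b
  Y≡ = begin
    + (Q ℕ.∸ m)                ≡⟨ sym (trans (ℤP.m-n≡m⊖n Q m) (ℤP.⊖-≥ m≤Q)) ⟩
    + Q - + m                  ≡⟨ ring₁ (+ Q) y (+ m) ⟩
    (+ Q - y) - + m + y        ≡⟨ cong (λ z → z - + m + y) (a≡a%ℕn+[a/ℕn]*n (+ Q - y) b) ⟩
    (+ m + h * + b) - + m + y  ≡⟨ ring₂ (+ m) h (+ b) y ⟩
    y + h * + b                ∎
    where
    ring₁ : ∀ Q y m → Q - m ≡ (Q - y) - m + y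
    ring₁ = solve-∀
    ring₂ : ∀ m h b y → (m + h * b) - m + y ≡ y + h * b
    ring₂ = solve-∀
  Q<b+Y : Q ℕ.< b ℕ.+ (Q ℕ.∸ m)
  Q<b+Y = subst (ℕ._< b ℕ.+ (Q ℕ.∸ m)) (ℕP.m+[n∸m]≡n m≤Q) (ℕP.+-monoˡ-< (Q ℕ.∸ m) m<b)

-- A solution of bX = aY + 1 with Y in the window (Q − b, Q] and X/Y in
-- lowest terms; X/Y will be the successor of a/b in F_Q.
record BezoutWindow (Q a b : ℕ) : Set where
  field
    X Y     : ℕ
    bezout  : b ℕ.* X ≡ a ℕ.* Y ℕ.+ 1
    1≤X     : 1 ℕ.≤ X
    X≤Y     : X ℕ.≤ Y
    Y≤Q     : Y ℕ.≤ Q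
    Q<b+Y   : Q ℕ.< b ℕ.+ Y
    coprime : gcd X Y ≡ 1

window-from-solution : ∀ Q a b X Y → b ℕ.≤ Q → a ℕ.< b → Y ℕ.≤ Q → Q ℕ.< b ℕ.+ Y →
  + b * X ≡ + a * + Y + + 1 → BezoutWindow Q a b
window-from-solution Q a b X Y b≤Q a<b Y≤Q Q<b+Y bX≡ = record
  { X = ∣X∣ ; Y = Y ; bezout = bezout ; 1≤X = 1≤X ; X≤Y = X≤Y ; Y≤Q = Y≤Q ; Q<b+Y = Q<b+Y
  ; coprime = coprime⇒gcd≡1 {∣X∣} {Y} (Bézout-coprime {d = 1} (Bézout.+- b a bezout′)) }
  where
  ∣X∣ : ℕ
  ∣X∣ = ℤ.∣ X ∣
  bX-positive : + 0 ℤ.< + b * X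
  bX-positive = subst (+ 0 ℤ.<_) (sym (trans bX≡ (cong (_+ + 1) (sym (ℤP.pos-* a Y)))))
                      (ℤ.+<+ (subst (0 ℕ.<_) (ℕP.+-comm 1 (a ℕ.* Y)) (s≤s z≤n)))
  X-positive : + 0 ℤ.< X
  X-positive = ℤP.*-cancelˡ-<-nonNeg (+ b) (subst (ℤ._< + b * X) (sym (ℤP.*-zeroʳ (+ b))) bX-positive)
  X≡ : + ∣X∣ ≡ X
  X≡ = ℤP.0≤i⇒+∣i∣≡i (ℤP.<⇒≤ X-positive)
  bezout : b ℕ.* ∣X∣ ≡ a ℕ.* Y ℕ.+ 1
  bezout = ℤP.+-injective (begin
    + (b ℕ.* ∣X∣)      ≡⟨ ℤP.pos-* b ∣X∣ ⟩
    + b * + ∣X∣        ≡⟨ cong (+ b *_) X≡ ⟩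
    + b * X            ≡⟨ bX≡ ⟩
    + a * + Y + + 1    ≡⟨ cong (_+ + 1) (sym (ℤP.pos-* a Y)) ⟩
    + (a ℕ.* Y ℕ.+ 1)  ∎)
    where open ≡-Reasoning
  bezout′ : 1 ℕ.+ a ℕ.* (Y ℕ.* 1) ≡ b ℕ.* (∣X∣ ℕ.* 1)
  bezout′ rewrite ℕP.*-identityʳ Y | ℕP.*-identityʳ ∣X∣ = trans (ℕP.+-comm 1 (a ℕ.* Y)) (sym bezout)
  1≤X : 1 ℕ.≤ ∣X∣
  1≤X = ℤP.drop‿+<+ (subst (+ 0 ℤ.<_) (sym X≡) X-positive)
  1≤Y : 1 ℕ.≤ Y
  1≤Y = ℕP.+-cancelˡ-< b 0 Y (ℕP.≤-<-trans (ℕP.≤-reflexive (ℕP.+-identityʳ b)) (ℕP.≤-<-trans b≤Q Q<b+Y))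
  X≤Y : ∣X∣ ℕ.≤ Y
  X≤Y = ℕP.*-cancelˡ-≤ b {{ℕ.>-nonZero (ℕP.≤-<-trans z≤n a<b)}} (begin
    b ℕ.* ∣X∣          ≡⟨ bezout ⟩
    a ℕ.* Y ℕ.+ 1      ≤⟨ ℕP.+-monoʳ-≤ (a ℕ.* Y) 1≤Y ⟩
    a ℕ.* Y ℕ.+ Y      ≡⟨ ℕP.+-comm (a ℕ.* Y) Y ⟩
    suc a ℕ.* Y        ≤⟨ ℕP.*-monoˡ-≤ Y a<b ⟩
    b ℕ.* Y            ∎)
    where open ℕP.≤-Reasoning

-- Every reduced a/b with a < b ≤ Q has a Bézout window: shift a Bézout
-- solution (s, y) by a multiple of (a, b) until y lands in (Q − b, Q].
bezout-window : ∀ Q a b → b ℕ.≤ Q → a ℕ.< b → gcd a b ≡ 1 → BezoutWindow Q a b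
bezout-window Q a b@(suc _) b≤Q a<b coprime with bezout-integers a b coprime
... | s , y , bs≡ay+1 with representative-in-window Q b b≤Q y
...   | Y , h , Y≡ , Y≤Q , Q<b+Y =
  window-from-solution Q a b (s + + a * h) Y b≤Q a<b Y≤Q Q<b+Y (begin
    + b * (s + + a * h)             ≡⟨ ring₁ (+ a) (+ b) s h ⟩
    + b * s + + a * h * + b         ≡⟨ cong (_+ + a * h * + b) bs≡ay+1 ⟩
    + a * y + + 1 + + a * h * + b   ≡⟨ ring₂ (+ a) (+ b) y h ⟩
    + a * (y + h * + b) + + 1       ≡⟨ cong (λ z → + a * z + + 1) (sym Y≡) ⟩
    + a * + Y + + 1                 ∎)
  where
  open ≡-Reasoning
  ring₁ : ∀ a b s h → b * (s + a * h) ≡ b * s + a * h * b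
  ring₁ = solve-∀
  ring₂ : ∀ a b y h → a * y + + 1 + a * h * b ≡ a * (y + h * b) + + 1
  ring₂ = solve-∀

*<*-in-ℤ : ∀ m n k l → m ℕ.* n ℕ.< k ℕ.* l → + m * + n ℤ.< + k * + l
*<*-in-ℤ m n k l lt = subst₂ ℤ._<_ (ℤP.pos-* m n) (ℤP.pos-* k l) (ℤ.+<+ lt)

-- If bX = aY + 1, every fraction c/d strictly between a/b and X/Y has
-- d ≥ b + Y, because d = b·(Xd − cY) + Y·(cb − ad) with both brackets ≥ 1.
between-denominator : ∀ a b c d X Y → b ℕ.* X ≡ a ℕ.* Y ℕ.+ 1 →
  a ℕ.* d ℕ.< c ℕ.* b → c ℕ.* Y ℕ.< X ℕ.* d → b ℕ.+ Y ℕ.≤ d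
between-denominator a b c d X Y bezout ad<cb cY<Xd = ℤP.drop‿+≤+ (begin
  + b + + Y                      ≡⟨ sym (cong₂ _+_ (ℤP.*-identityʳ (+ b)) (ℤP.*-identityʳ (+ Y))) ⟩
  + b * + 1 + + Y * + 1          ≤⟨ ℤP.+-mono-≤ (ℤP.*-monoˡ-≤-nonNeg (+ b) (1≤difference right-gap))
                                                (ℤP.*-monoˡ-≤-nonNeg (+ Y) (1≤difference left-gap)) ⟩
  + b * right + + Y * left       ≡⟨ sym d≡ ⟩
  + d                            ∎)
  where
  open ℤP.≤-Reasoning
  right left : ℤ
  right = + X * + d - + c * + Y
  left  = + c * + b - + a * + d
  right-gap : + c * + Y ℤ.< + X * + d
  right-gap = *<*-in-ℤ c Y X d cY<Xd
  left-gap : + a * + d ℤ.< + c * + b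
  left-gap = *<*-in-ℤ a d c b ad<cb
  1≤difference : ∀ {i j} → i ℤ.< j → + 1 ℤ.≤ j - i
  1≤difference {i} {j} i<j = subst (ℤ._≤ j - i) (ring i) (ℤP.+-monoˡ-≤ (- i) (ℤP.i<j⇒suc[i]≤j i<j))
    where
    ring : ∀ i → (+ 1 + i) - i ≡ + 1
    ring = solve-∀
  unimodular : + b * + X - + a * + Y ≡ + 1
  unimodular = trans (cong₂ _-_ (sym (ℤP.pos-* b X)) (sym (ℤP.pos-* a Y)))
                     (trans (cong (λ z → + z - + (a ℕ.* Y)) bezout) (ring (+ (a ℕ.* Y))))
    where
    ring : ∀ z → z + + 1 - z ≡ + 1
    ring = solve-∀
  d≡ : + d ≡ + b * right + + Y * left
  d≡ = trans (sym (ℤP.*-identityʳ (+ d)))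
             (trans (cong (+ d *_) (sym unimodular)) (ring (+ a) (+ b) (+ c) (+ d) (+ X) (+ Y)))
    where
    ring : ∀ a b c d X Y → d * (b * X - a * Y) ≡ b * (X * d - c * Y) + Y * (c * b - a * d)
    ring = solve-∀

module CrossMultiplication {x y : ℚ} {a b c d : ℕ}
  (↥x : ↥ x ≡ + a) (↧x : ↧ x ≡ + b) (↥y : ↥ y ≡ + c) (↧y : ↧ y ≡ + d) where

  ↥x↧y : ↥ x * ↧ y ≡ + (a ℕ.* d)
  ↥x↧y = trans (cong₂ _*_ ↥x ↧y) (sym (ℤP.pos-* a d))

  ↥y↧x : ↥ y * ↧ x ≡ + (c ℕ.* b)
  ↥y↧x = trans (cong₂ _*_ ↥y ↧x) (sym (ℤP.pos-* c b))

  <⇒cross : x ℚ.< y → a ℕ.* d ℕ.< c ℕ.* b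
  <⇒cross (*<* lt) = ℤP.drop‿+<+ (subst₂ ℤ._<_ ↥x↧y ↥y↧x lt)

  cross⇒< : a ℕ.* d ℕ.< c ℕ.* b → x ℚ.< y
  cross⇒< lt = *<* (subst₂ ℤ._<_ (sym ↥x↧y) (sym ↥y↧x) (ℤ.+<+ lt))

  ≤⇒cross : x ℚ.≤ y → a ℕ.* d ℕ.≤ c ℕ.* b
  ≤⇒cross (*≤* le) = ℤP.drop‿+≤+ (subst₂ ℤ._≤_ ↥x↧y ↥y↧x le)

  cross⇒≡ : a ℕ.* d ≡ c ℕ.* b → x ≡ y
  cross⇒≡ eq = ℚP.≃⇒≡ (*≡* (trans ↥x↧y (trans (cong +_ eq) (sym ↥y↧x))))

module Enumeration {Q : ℕ} {L : List ℚ} (E : Enumerates Q L) where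
  open Enumerates E
  open StrictlyIncreasing

  -- The neighbour property: if v is the least member of F_Q above u ∈ F_Q,
  -- then det u v = 1.  Writing u = a/b, the Bézout fraction X/Y lies in
  -- F_Q above u, so v ≤ X/Y; a strict inequality would force a denominator
  -- d ≥ b + Y > Q for v, hence v = X/Y and det u v = bX − aY = 1.
  successor-det : ∀ {u v} → u ∈ L → v ∈ L → u ℚ.< v →
    (∀ {w} → w ∈ L → u ℚ.< w → v ℚ.≤ w) → det u v ≡ + 1
  successor-det {u} {v} u∈ v∈ u<v v-least = begin
    ↥ v * ↧ u - ↥ u * ↧ v           ≡⟨ cong (λ z → ↥ z * ↧ u - ↥ u * ↧ z) v≡w ⟩
    ↥ w * ↧ u - ↥ u * ↧ w           ≡⟨ cong₂ _-_ (cong₂ _*_ B.num U.den) (cong₂ _*_ U.num B.den) ⟩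
    + X * + b - + a * + Y           ≡⟨ cong₂ _-_ (trans (sym (ℤP.pos-* X b)) (cong +_ (trans (ℕP.*-comm X b) W.bezout)))
                                                 (sym (ℤP.pos-* a Y)) ⟩
    + (a ℕ.* Y) + + 1 - + (a ℕ.* Y) ≡⟨ ring (+ (a ℕ.* Y)) ⟩
    + 1                             ∎
    where
    open ≡-Reasoning
    module U = FareyFraction (member⁻ u∈)
    module V = FareyFraction (member⁻ v∈)
    a b c d : ℕ
    a = U.a
    b = U.b
    c = V.a
    d = V.b
    ad<cb : a ℕ.* d ℕ.< c ℕ.* b
    ad<cb = CrossMultiplication.<⇒cross U.num U.den V.num V.den u<v
    a<b : a ℕ.< b
    a<b = ℕP.*-cancelʳ-< d a b (ℕP.<-≤-trans ad<cb (ℕP.≤-trans (ℕP.*-monoˡ-≤ b V.a≤b) (ℕP.≤-reflexive (ℕP.*-comm d b))))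
    module W = BezoutWindow (bezout-window Q a b U.b≤Q a<b U.coprime)
    X Y : ℕ
    X = W.X
    Y = W.Y
    module B = MemberWith (member⁺ X Y W.1≤X W.X≤Y W.Y≤Q W.coprime)
    w : ℚ
    w = B.w
    u<w : u ℚ.< w
    u<w = CrossMultiplication.cross⇒< U.num U.den B.num B.den
            (subst (a ℕ.* Y ℕ.<_) (trans (sym W.bezout) (ℕP.*-comm b X)) (ℕP.m<m+n (a ℕ.* Y) (s≤s z≤n)))
    v≤w : c ℕ.* Y ℕ.≤ X ℕ.* d
    v≤w = CrossMultiplication.≤⇒cross V.num V.den B.num B.den (v-least B.∈L u<w)
    v≡w : v ≡ w
    v≡w with ℕP.m≤n⇒m<n∨m≡n v≤w
    ... | inj₁ v<w = ⊥-elim (ℕP.<-irrefl refl (ℕP.<-≤-trans W.Q<b+Y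
            (ℕP.≤-trans (between-denominator a b c d X Y W.bezout ad<cb v<w) V.b≤Q)))
    ... | inj₂ v≗w = CrossMultiplication.cross⇒≡ V.num V.den B.num B.den v≗w
    ring : ∀ z → z + + 1 - z ≡ + 1
    ring = solve-∀

  module Positions (n : ℕ) (len : length L ≡ suc n) where

    in-range : ∀ {r} → r ℕ.< suc n → r ℕ.< length L
    in-range {r} = subst (r ℕ.<_) (sym len)

    position-∈ : ∀ r → r ℕ.≤ n → nth L r ∈ L
    position-∈ r r≤n = nth-∈ L r (in-range (s≤s r≤n))

    consecutive-det : ∀ r → suc r ℕ.< suc n → det (nth L r) (nth L (suc r)) ≡ + 1
    consecutive-det r r+1<M = successor-det
      (position-∈ r (ℕP.<⇒≤ (ℕ.s≤s⁻¹ r+1<M))) (position-∈ (suc r) (ℕ.s≤s⁻¹ r+1<M))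
      (nth-< L increasing r (in-range r+1<M))
      (nth-next-least L increasing r (in-range r+1<M))

    -- the least member a/b satisfies a ≤ 1, since 1/b ∈ F_Q
    first-numerator : ↥ nth L 0 ≡ + 1
    first-numerator = trans F.num (cong +_ (ℕP.≤-antisym a≤1 F.1≤a))
      where
      module F = FareyFraction (member⁻ (position-∈ 0 z≤n))
      module 1/b = MemberWith (member⁺ 1 F.b ℕP.≤-refl (ℕP.≤-trans F.1≤a F.a≤b) F.b≤Q (gcd-zeroˡ F.b))
      a≤1 : F.a ℕ.≤ 1
      a≤1 = ℕP.*-cancelʳ-≤ F.a 1 F.b {{ℕ.>-nonZero (ℕP.<-≤-trans F.1≤a F.a≤b)}}
        (CrossMultiplication.≤⇒cross F.num F.den 1/b.num 1/b.den (nth-first-least L increasing 1/b.∈L))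

    -- the greatest member a/b satisfies b ≤ a, since 1/1 ∈ F_Q; so a = b = 1
    last-is-one : ↥ nth L n ≡ + 1 × ↧ nth L n ≡ + 1
    last-is-one = trans G.num (cong +_ a≡1) , trans G.den (cong +_ (trans (sym a≡b) a≡1))
      where
      module G = FareyFraction (member⁻ (position-∈ n ℕP.≤-refl))
      module 1/1 = MemberWith (member⁺ 1 1 ℕP.≤-refl ℕP.≤-refl (ℕP.≤-trans G.1≤a (ℕP.≤-trans G.a≤b G.b≤Q)) (gcd-zeroˡ 1))
      b≤a : G.b ℕ.≤ G.a
      b≤a = subst₂ ℕ._≤_ (ℕP.*-identityˡ G.b) (ℕP.*-identityʳ G.a)
        (CrossMultiplication.≤⇒cross 1/1.num 1/1.den G.num G.den (nth-last-greatest L n len increasing 1/1.∈L))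
      a≡b : G.a ≡ G.b
      a≡b = ℕP.≤-antisym G.a≤b b≤a
      a≡1 : G.a ≡ 1
      a≡1 = ∣1⇒≡1 (subst (G.a ∣_) (trans (cong (gcd G.a) a≡b) G.coprime) (gcd-greatest (∣-refl {G.a}) (∣-refl {G.a})))

    -- x_n + m and x₀ + (m + 1) are neighbours, because x₀ = 1/Q and x_n = 1/1
    wrap : (↥ nth L 0 + ↧ nth L 0) * ↧ nth L n - ↥ nth L n * ↧ nth L 0 ≡ + 1
    wrap = endpoints first-numerator (proj₁ last-is-one) (proj₂ last-is-one)
      where
      endpoints : ∀ {a₀ b₀ aₙ bₙ} → a₀ ≡ + 1 → aₙ ≡ + 1 → bₙ ≡ + 1 → (a₀ + b₀) * bₙ - aₙ * b₀ ≡ + 1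
      endpoints {b₀ = b₀} refl refl refl = ring b₀
        where
        ring : ∀ b → (+ 1 + b) * + 1 - + 1 * b ≡ + 1
        ring = solve-∀

unimodular-translate : ∀ {p q p′ q′ : ℤ → ℤ} s → (∀ j → p′ j ≡ p (j - s)) → (∀ j → q′ j ≡ q (j - s)) →
  Minors.Unimodular p q → Minors.Unimodular p′ q′
unimodular-translate {p} {q} {p′} {q′} s p′≡ q′≡ uni j = begin
  p′ (j + + 1) * q′ j - p′ j * q′ (j + + 1)
    ≡⟨ cong₂ _-_ (cong₂ _*_ (p′≡ (j + + 1)) (q′≡ j)) (cong₂ _*_ (p′≡ j) (q′≡ (j + + 1))) ⟩
  p (j + + 1 - s) * q (j - s) - p (j - s) * q (j + + 1 - s)
    ≡⟨ cong (λ k → p k * q (j - s) - p (j - s) * q k) (commute j s) ⟩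
  p (j - s + + 1) * q (j - s) - p (j - s) * q (j - s + + 1)
    ≡⟨ uni (j - s) ⟩
  + 1 ∎
  where
  open ≡-Reasoning
  commute : ∀ j s → j + + 1 - s ≡ j - s + + 1
  commute = solve-∀

-- `numer Q` and `denom Q` are the periodic extension of `farey Q`,
-- translated by one since γ₁ is the first list entry.
numer-extension : ∀ Q n → N Q ≡ suc n → ∀ i → numer Q i ≡ PeriodicExtension.extNum (farey Q) n (i - + 1)
numer-extension Q n len i with N Q | len
... | .(suc n) | refl = refl

denom-extension : ∀ Q n → N Q ≡ suc n → ∀ i → denom Q i ≡ PeriodicExtension.extDen (farey Q) n (i - + 1)
denom-extension Q n len i with N Q | len
... | .(suc n) | refl = refl

∈⇒length≡suc : ∀ {x : ℚ} {L} → x ∈ L → length L ≡ suc (ℕ.pred (length L))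
∈⇒length≡suc {L = _ ∷ _} _ = refl

farey-unimodular : ∀ Q → 1 ℕ.≤ Q → Minors.Unimodular (numer Q) (denom Q)
farey-unimodular Q 1≤Q =
  -- the sequences are passed explicitly: inferring them would make Agda
  -- evaluate the sorting of `farey Q`
  unimodular-translate {p = E.extNum} {q = E.extDen} {p′ = numer Q} {q′ = denom Q} (+ 1)
    (numer-extension Q n len) (denom-extension Q n len)
    (E.extension-unimodular consecutive-det wrap)
  where
  n : ℕ
  n = ℕ.pred (N Q)
  len : N Q ≡ suc n
  len = ∈⇒length≡suc (MemberWith.∈L (Enumerates.member⁺ (farey-enumerates Q) 1 1 ℕP.≤-refl ℕP.≤-refl 1≤Q (gcd-zeroˡ 1)))
  module E = PeriodicExtension (farey Q) n
  open Enumeration.Positions (farey-enumerates Q) n len using (consecutive-det; wrap)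

lemma1 : (Q : ℕ) → Q ≥ 2 → (i : ℤ) → (k : ℕ) → k ≥ 3 →
    InSL₂ℤ (ν Q (k Data.Nat.∸ 1) i) (ν Q k i)
           (ν Q (k Data.Nat.∸ 2) (i + + 1)) (ν Q (k Data.Nat.∸ 1) (i + + 1))
lemma1 Q Q≥2 i (suc zero) (s≤s ())
lemma1 Q Q≥2 i (suc (suc m)) _ =
  Minors.index-matrix-SL₂ (numer Q) (denom Q) (farey-unimodular Q (ℕP.≤-trans (s≤s z≤n) Q≥2)) i m
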